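{- For $r\ge 1$ let $g(r)$ denote the maximum, over all outerplanar graphs $G$ with an outerplanar embedding and pairs of vertices $u,v$ that are consecutive on the outer face, of the number of paths in $G$ with $r$ edges whose endvertices are $u$ and $v$. Then $g(r)\le \mathcal{C}(r-1)$, where $\mathcal{C}(m)=\frac{1}{m+1}\binom{2m}{m}$ is the $m$-th Catalan number.
   Context: A graph is outerplanar if it has a planar embedding with all vertices on the outer face (outerplanar embedding). -}

module Defs where

open import Data.Nat using (ℕ; zero; suc; _+_; _*_; _/_; _<_)
open import Data.Nat.Combinatorics using (_C_)
open import Data.Fin using (Fin; toℕ; inject₁) renaming (suc to fsuc)
open import Data.Fin.Permutation using (Permutation′; _⟨$⟩ʳ_)
open import Data.Vec using (Vec; head; last; lookup)
open import Data.Product using (_×_)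
open import Data.Sum using (_⊎_)
open import Data.Empty using (⊥)
open import Relation.Nullary using (¬_)
open import Relation.Binary.PropositionalEquality using (_≡_; _≢_)
open import Level using (0ℓ)

catalan : ℕ → ℕ
catalan m = ((2 * m) C m) / suc m

record Graph (n : ℕ) : Set₁ where
  field
    Adj   : Fin n → Fin n → Set
    sym   : ∀ {x y} → Adj x y → Adj y x
    irrefl : ∀ {x} → ¬ Adj x x
open Graph public

-- An outerplanar embedding: the vertices are placed on a circle (the outer
-- face) in the cyclic order given by the position map π, and edges are drawn
-- as non-crossing chords inside the disc.
record OuterplanarEmbedding {n : ℕ} (G : Graph n) : Set where
  field
    pos : Permutation′ n
    noCrossing : ∀ {a b c d} → Adj G a b → Adj G c d →
      ¬ ( (toℕ (pos ⟨$⟩ʳ a) < toℕ (pos ⟨$⟩ʳ c))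
        × (toℕ (pos ⟨$⟩ʳ c) < toℕ (pos ⟨$⟩ʳ b))
        × (toℕ (pos ⟨$⟩ʳ b) < toℕ (pos ⟨$⟩ʳ d)) )
open OuterplanarEmbedding public

Consecutive : ∀ {n} {G : Graph n} → OuterplanarEmbedding G → Fin n → Fin n → Set
Consecutive {n} E u v =
    (suc (toℕ (pos E ⟨$⟩ʳ u)) ≡ toℕ (pos E ⟨$⟩ʳ v))
  ⊎ (suc (toℕ (pos E ⟨$⟩ʳ v)) ≡ toℕ (pos E ⟨$⟩ʳ u))
  ⊎ ((toℕ (pos E ⟨$⟩ʳ u) ≡ 0) × (suc (toℕ (pos E ⟨$⟩ʳ v)) ≡ n) × (u ≢ v))
  ⊎ ((toℕ (pos E ⟨$⟩ʳ v) ≡ 0) × (suc (toℕ (pos E ⟨$⟩ʳ u)) ≡ n) × (u ≢ v))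

record IsPath {n : ℕ} (G : Graph n) (r : ℕ) (u v : Fin n) (p : Vec (Fin n) (suc r)) : Set where
  field
    start    : head p ≡ u
    end      : last p ≡ v
    distinct : ∀ i j → lookup p i ≡ lookup p j → i ≡ j
    edges    : ∀ (i : Fin r) → Adj G (lookup p (inject₁ i)) (lookup p (fsuc i))

-- Cut the circle of the embedding between v and u, reflecting it first if v comes right
-- after u: this gives an arc diagram, with the vertices on a line, u leftmost, v rightmost
-- and the edges as pairwise non-crossing arcs on one side of the line.  Every u–v path in it
-- is increasing: after a step x → y from the leftmost vertex x still to be visited, a path
-- that went left of y would have to cross the arc x–y to reach v.  An increasing path is
-- counted through stops it must visit, initially just v: its next step either reaches the
-- next stop or is a detour to an inner vertex before it, and all detours pass through the
-- widest such vertex w, which can then be made a stop.  Hence the paths with i inner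
-- vertices and k stops number at most ballot i k, where
-- ballot i (k + 1) = ballot i k + ballot (i − 1) (k + 2), and ballot (r − 1) 1 is the
-- Catalan number C(r − 1).
module Submission where

open import Defs
open import Data.Nat using (ℕ; suc; _≤_; _∸_)
open import Data.Fin using (Fin)
open import Data.Vec using (Vec)
open import Data.List using (List; length)
open import Data.List.Relation.Unary.All using (All)
open import Data.List.Relation.Unary.Unique.Propositional using (Unique)

open import Data.Bool using (Bool; true; false)
open import Data.Empty using (⊥; ⊥-elim)
open import Data.Fin using (toℕ; inject₁) renaming (zero to fzero; suc to fsuc)
open import Data.Fin.Permutation using (_⟨$⟩ʳ_)
import Data.Fin.Properties as Fin
open import Data.List using ([]; _∷_; map; filter; head; last; drop)
open import Data.List.Extrema.Nat using (argmax-all; f[⊥]≤f[argmax]; f[xs]≤f[argmax])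
open import Data.List.Properties using (length-map)
open import Data.List.Relation.Unary.All as All using ([]; _∷_)
import Data.List.Relation.Unary.All.Properties as All
open import Data.List.Relation.Unary.AllPairs using ([]; _∷_)
import Data.List.Relation.Unary.Unique.Propositional.Properties as Unique
open import Data.List.Relation.Unary.Linked as Linked using (Linked; [-]; _∷_)
open import Data.Maybe using (just)
import Data.Maybe.Properties as Maybe
import Data.Maybe.Relation.Unary.All as Maybe
open import Data.Nat
open import Data.Nat.Combinatorics
  using (_C_; nCk+nC[k+1]≡[n+1]C[k+1]; k>n⇒nCk≡0; k![n∸k]!∣n!; [n-k]*d[k+1]≡[k+1]*d[k])
open import Data.Nat.Combinatorics.Specification using (nCk≡n!/k![n-k]!)
open import Data.Nat.DivMod using (m*n/n≡m; m/n*n≡m)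
open import Data.Nat.Properties
open import Algebra.Properties.CommutativeSemigroup +-commutativeSemigroup using (interchange)
open import Algebra.Properties.CommutativeSemigroup *-commutativeSemigroup
  using (xy∙z≈xz∙y; xy∙z≈x∙zy)
open import Data.Product using (_×_; _,_; ∃-syntax; Σ-syntax)
open import Data.Sum using (inj₁; inj₂)
import Data.Vec as Vec
open import Data.Vec using ([]; _∷_; lookup; toList)
import Data.Vec.Properties as Vec
import Data.Vec.Relation.Unary.All as VecAll
import Data.Vec.Relation.Unary.All.Properties as VecAll
open import Function using (_∘_)
open import Function.Bundles using (Injection)
open import Function.Properties.Inverse using (↔⇒↣)
open import Level using (0ℓ)
open import Relation.Binary.Definitions using (DecidableEquality; tri<; tri≈; tri>)
open import Relation.Binary.PropositionalEquality hiding (sym)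
import Relation.Binary.PropositionalEquality as ≡
open import Relation.Nullary using (¬_; Dec; does; yes; no)
open import Relation.Nullary.Decidable using (map′)
open import Relation.Unary using (Pred; Decidable; _∩_; ∁)
open import Relation.Unary.Properties using (∁?)

ballot : ℕ → ℕ → ℕ
ballot zero    _       = 1
ballot (suc i) zero    = 0
ballot (suc i) (suc k) = ballot (suc i) k + ballot i (suc (suc k))

ballot-binomial-step : ∀ {b₁ b₂ m i j} →
  b₁ + m C suc j ≡ m C suc i → b₂ + m C suc (suc j) ≡ m C i →
  b₁ + b₂ + suc m C suc (suc j) ≡ suc m C suc i
ballot-binomial-step {b₁} {b₂} {m} {i} {j} e₁ e₂ = begin
  b₁ + b₂ + suc m C suc (suc j)
    ≡⟨ cong (b₁ + b₂ +_) (nCk+nC[k+1]≡[n+1]C[k+1] m (suc j)) ⟨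
  b₁ + b₂ + (m C suc j + m C suc (suc j))   ≡⟨ interchange b₁ b₂ _ _ ⟩
  (b₁ + m C suc j) + (b₂ + m C suc (suc j)) ≡⟨ cong₂ _+_ e₁ e₂ ⟩
  m C suc i + m C i                         ≡⟨ +-comm (m C suc i) (m C i) ⟩
  m C i + m C suc i                         ≡⟨ nCk+nC[k+1]≡[n+1]C[k+1] m i ⟩
  suc m C suc i                             ∎
  where open ≡-Reasoning

-- The reflection principle ballot (i + 1) k = C(n, i + 1) − C(n, k + i + 1) for
-- n = k + 2i + 1, stated without subtraction.
ballot-binomial : ∀ i k →
  ballot (suc i) k + suc (k + i + i) C suc (k + i) ≡ suc (k + i + i) C suc i
ballot-binomial i       zero    = refl
ballot-binomial zero    (suc k) =
  ballot-binomial-step {m = suc (k + 0 + 0)} {i = 0} {j = k + 0}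
    (ballot-binomial zero k)
    (cong suc (k>n⇒nCk≡0 (s≤s (s≤s (≤-reflexive (+-identityʳ (k + 0)))))))
ballot-binomial (suc i) (suc k) =
  ballot-binomial-step {m = suc (k + suc i + suc i)} {i = suc i} {j = k + suc i}
    (ballot-binomial (suc i) k)
    (subst₂ (λ m j → ballot (suc i) (2 + k) + suc m C j ≡ suc m C suc i)
      (≡.sym (trans (+-suc (k + suc i) i) (cong (λ x → suc (x + i)) (+-suc k i))))
      (cong (suc ∘ suc) (≡.sym (+-suc k i)))
      (ballot-binomial i (suc (suc k))))

nCk*[k!*[n∸k]!]≡n! : ∀ {n k} → k ≤ n → (n C k) * (k ! * (n ∸ k) !) ≡ n !
nCk*[k!*[n∸k]!]≡n! {n} {k} k≤n = trans (cong (_* (k ! * (n ∸ k) !)) (nCk≡n!/k![n-k]! k≤n))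
  (m/n*n≡m {{k !* (n ∸ k) !≢0}} (k![n∸k]!∣n! k≤n))

nCk*[n∸k]≡nC[1+k]*[1+k] : ∀ n k → (n C k) * (n ∸ k) ≡ (n C suc k) * suc k
nCk*[n∸k]≡nC[1+k]*[1+k] n k with k <? n
... | yes k<n = *-cancelʳ-≡ _ _ d[k] {{k !* (n ∸ k) !≢0}} (begin
  (n C k) * (n ∸ k) * d[k]           ≡⟨ xy∙z≈xz∙y (n C k) (n ∸ k) d[k] ⟩
  (n C k) * d[k] * (n ∸ k)           ≡⟨ cong (_* (n ∸ k)) (nCk*[k!*[n∸k]!]≡n! (<⇒≤ k<n)) ⟩
  n ! * (n ∸ k)                      ≡⟨ cong (_* (n ∸ k)) (nCk*[k!*[n∸k]!]≡n! k<n) ⟨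
  (n C suc k) * d[k+1] * (n ∸ k)     ≡⟨ xy∙z≈x∙zy (n C suc k) d[k+1] (n ∸ k) ⟩
  (n C suc k) * ((n ∸ k) * d[k+1])   ≡⟨ cong ((n C suc k) *_) ([n-k]*d[k+1]≡[k+1]*d[k] k<n) ⟩
  (n C suc k) * (suc k * d[k])       ≡⟨ *-assoc (n C suc k) (suc k) d[k] ⟨
  (n C suc k) * suc k * d[k]         ∎)
  where
  open ≡-Reasoning
  d[k] = k ! * (n ∸ k) !
  d[k+1] = suc k ! * (n ∸ suc k) !
... | no k≮n = begin
  (n C k) * (n ∸ k)   ≡⟨ cong ((n C k) *_) (m≤n⇒m∸n≡0 (≮⇒≥ k≮n)) ⟩
  (n C k) * 0         ≡⟨ *-zeroʳ (n C k) ⟩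
  0                   ≡⟨ cong (_* suc k) (k>n⇒nCk≡0 (s≤s (≮⇒≥ k≮n))) ⟨
  (n C suc k) * suc k ∎
  where open ≡-Reasoning

x+[2m]C[1+m]≡[2m]Cm⇒x*[1+m]≡[2m]Cm : ∀ m x →
  x + (2 * m) C suc m ≡ (2 * m) C m → x * suc m ≡ (2 * m) C m
x+[2m]C[1+m]≡[2m]Cm⇒x*[1+m]≡[2m]Cm m x x+B≡A = +-cancelʳ-≡ (A * m) (x * suc m) A (begin
  x * suc m + A * m     ≡⟨ cong (x * suc m +_) A*m≡B*[1+m] ⟩
  x * suc m + B * suc m ≡⟨ *-distribʳ-+ (suc m) x B ⟨
  (x + B) * suc m       ≡⟨ cong (_* suc m) x+B≡A ⟩
  A * suc m             ≡⟨ *-suc A m ⟩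
  A + A * m             ∎)
  where
  open ≡-Reasoning
  A = (2 * m) C m
  B = (2 * m) C suc m
  A*m≡B*[1+m] : A * m ≡ B * suc m
  A*m≡B*[1+m] = trans (cong (A *_) (≡.sym (trans (m+n∸m≡n m (m + 0)) (+-identityʳ m))))
    (nCk*[n∸k]≡nC[1+k]*[1+k] (2 * m) m)

ballot[m,1]*[1+m]≡[2m]Cm : ∀ m → ballot m 1 * suc m ≡ (2 * m) C m
ballot[m,1]*[1+m]≡[2m]Cm zero    = refl
ballot[m,1]*[1+m]≡[2m]Cm (suc i) =
  x+[2m]C[1+m]≡[2m]Cm⇒x*[1+m]≡[2m]Cm (suc i) (ballot (suc i) 1)
    (subst (λ n → ballot (suc i) 1 + n C suc (suc i) ≡ n C suc i) 2+2i≡2[1+i] (ballot-binomial i 1))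
  where
  2+2i≡2[1+i] : 2 + (i + i) ≡ 2 * suc i
  2+2i≡2[1+i] = cong suc (≡.sym (trans (+-suc i (i + 0)) (cong (λ j → suc (i + j)) (+-identityʳ i))))

ballot-catalan : ∀ m → ballot m 1 ≡ catalan m
ballot-catalan m = begin
  ballot m 1                 ≡⟨ m*n/n≡m (ballot m 1) (suc m) ⟨
  ballot m 1 * suc m / suc m ≡⟨ cong (_/ suc m) (ballot[m,1]*[1+m]≡[2m]Cm m) ⟩
  catalan m                  ∎
  where open ≡-Reasoning

AtMost : {A : Set} → ℕ → Pred A 0ℓ → Set
AtMost {A} N P = (xs : List A) → Unique xs → All P xs → length xs ≤ N

length-filter+length-filter-∁ : ∀ {A : Set} {Q : Pred A 0ℓ} (Q? : Decidable Q) xs →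
  length (filter Q? xs) + length (filter (∁? Q?) xs) ≡ length xs
length-filter+length-filter-∁ Q? []       = refl
length-filter+length-filter-∁ Q? (x ∷ xs) with Q? x
... | yes _ = cong suc (length-filter+length-filter-∁ Q? xs)
... | no  _ = trans (+-suc _ _) (cong suc (length-filter+length-filter-∁ Q? xs))

module _ {A : Set} {P : Pred A 0ℓ} where

  atMost-none : (∀ {x} → ¬ P x) → AtMost 0 P
  atMost-none ¬P []       _ _        = z≤n
  atMost-none ¬P (x ∷ xs) _ (px ∷ _) = ⊥-elim (¬P px)

  atMost-one : (∀ {x y} → P x → P y → x ≡ y) → AtMost 1 P
  atMost-one same []           _               _             = z≤n
  atMost-one same (x ∷ [])     _               _             = s≤s z≤n
  atMost-one same (x ∷ y ∷ xs) ((x≢y ∷ _) ∷ _) (px ∷ py ∷ _) = ⊥-elim (x≢y (same px py))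

  atMost-split : ∀ {Q : Pred A 0ℓ} {M N} → Decidable Q →
    AtMost M (P ∩ Q) → AtMost N (P ∩ ∁ Q) → AtMost (M + N) P
  atMost-split Q? atMost-Q atMost-∁Q xs xs! pxs = begin
    length xs                                          ≡⟨ length-filter+length-filter-∁ Q? xs ⟨
    length (filter Q? xs) + length (filter (∁? Q?) xs) ≤⟨ +-mono-≤
      (atMost-Q _ (Unique.filter⁺ Q? xs!) (restrict Q?))
      (atMost-∁Q _ (Unique.filter⁺ (∁? Q?) xs!) (restrict (∁? Q?))) ⟩
    _                                                  ∎
    where
    open ≤-Reasoning
    restrict : ∀ {R : Pred A 0ℓ} (R? : Decidable R) → All (P ∩ R) (filter R? xs)
    restrict R? = All.zip (All.filter⁺ R? pxs , All.all-filter R? xs)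

  atMost-injection : ∀ {B : Set} {Q : Pred B 0ℓ} {N} (f : A → B) →
    (∀ {x} → P x → Q (f x)) → (∀ {x y} → P x → P y → f x ≡ f y → x ≡ y) →
    AtMost N Q → AtMost N P
  atMost-injection f P⇒Q∘f f-inj atMost-Q xs xs! pxs =
    subst (_≤ _) (length-map f xs)
      (atMost-Q (map f xs) (map⁺ xs! pxs) (All.map⁺ (All.map P⇒Q∘f pxs)))
    where
    map⁺ : ∀ {xs} → Unique xs → All P xs → Unique (map f xs)
    map⁺ []         []         = []
    map⁺ (x∉ ∷ xs!) (px ∷ pxs) =
      All.map⁺ (All.zipWith (λ (x≢y , py) fx≡fy → x≢y (f-inj px py fx≡fy)) (x∉ , pxs))
      ∷ map⁺ xs! pxs

NonCrossing : {V : Set} → (V → V → Set) → (V → ℕ) → Set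
NonCrossing E κ = ∀ {a b c d} → E a b → E c d → ¬ (κ a < κ c × κ c < κ b × κ b < κ d)

record ArcDiagram {V : Set} (E : V → V → Set) : Set where
  field
    place             : V → ℕ
    place-injective   : ∀ {x y} → place x ≡ place y → x ≡ y
    place-nonCrossing : NonCrossing E place

Ends : ∀ {V : Set} {E : V → V → Set} → ArcDiagram E → V → V → Set
Ends D u v = (∀ x → place u ≤ place x) × (∀ x → place x ≤ place v)
  where open ArcDiagram D

module _ {V : Set} {E : V → V → Set} (D : ArcDiagram E) where

  open ArcDiagram D

  _≺_ _≼_ : V → V → Set
  x ≺ y = place x < place y
  x ≼ y = place x ≤ place y

  _≟ᵥ_ : DecidableEquality V
  x ≟ᵥ y = map′ place-injective (cong place) (place x ≟ place y)

  StartsWith : V → Pred (List V) 0ℓ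
  StartsWith y p = head p ≡ just y

  startsWith? : ∀ y → Decidable (StartsWith y)
  startsWith? y p = Maybe.≡-dec _≟ᵥ_ (head p) (just y)

  -- Ascent x bs p: the walk x ∷ p along arcs visits the stops bs in order and ends at the
  -- last one; each step reaches either the next stop or an inner vertex before it.
  data Ascent : V → List V → List V → Set where
    done    : ∀ {x} → Ascent x [] []
    toStop  : ∀ {x y bs p} → E x y → x ≺ y → Ascent y bs p → Ascent x (y ∷ bs) (y ∷ p)
    toInner : ∀ {x z y bs p} → E x z → x ≺ z → z ≺ y →
      Ascent z (y ∷ bs) p → Ascent x (y ∷ bs) (z ∷ p)

  Ascents : ℕ → V → List V → Pred (List V) 0ℓ
  Ascents i x bs p = Ascent x bs p × length p ≡ length bs + i

  Detours : ℕ → V → V → List V → Pred (List V) 0ℓ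
  Detours i x y bs = Ascents i x (y ∷ bs) ∩ ∁ (StartsWith y)

  ascent-length : ∀ {x bs p} → Ascent x bs p → length bs ≤ length p
  ascent-length done              = z≤n
  ascent-length (toStop _ _ a)    = s≤s (ascent-length a)
  ascent-length (toInner _ _ _ a) = m≤n⇒m≤1+n (ascent-length a)

  ascents₀⇒startsWith : ∀ {x y bs p} → Ascents 0 x (y ∷ bs) p → StartsWith y p
  ascents₀⇒startsWith (toStop _ _ _ , _)      = refl
  ascents₀⇒startsWith (toInner _ _ _ a , len) =
    ⊥-elim (1+n≰n (≤-trans (ascent-length a)
                            (≤-reflexive (trans (suc-injective len) (+-identityʳ _)))))

  atMost-toStop : ∀ {i x y bs N} →
    AtMost N (Ascents i y bs) → AtMost N (Ascents i x (y ∷ bs) ∩ StartsWith y)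
  atMost-toStop {i} {x} {y} {bs} = atMost-injection (drop 1) tail-ascent tail-injective
    where
    tail-ascent : ∀ {p} → (Ascents i x (y ∷ bs) ∩ StartsWith y) p → Ascents i y bs (drop 1 p)
    tail-ascent ((toStop _ _ a , len) , _)       = a , suc-injective len
    tail-ascent ((toInner _ _ y≺y _ , _) , refl) = ⊥-elim (<-irrefl refl y≺y)
    tail-injective : ∀ {p q} → (Ascents i x (y ∷ bs) ∩ StartsWith y) p →
      (Ascents i x (y ∷ bs) ∩ StartsWith y) q → drop 1 p ≡ drop 1 q → p ≡ q
    tail-injective {_ ∷ _} {_ ∷ _} (_ , refl) (_ , refl) = cong (y ∷_)

  -- An ascent from z below the arc a–w, with a ≺ z ≺ w, cannot pass over w without
  -- crossing that arc, so w can be added to its stops.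
  insert-stop : ∀ {a z w y bs p} → E a w → a ≺ z → z ≺ w → w ≺ y →
    Ascent z (y ∷ bs) p → Ascent z (w ∷ y ∷ bs) p
  insert-stop Eaw a≺z z≺w w≺y (toStop Ezy _ _) =
    ⊥-elim (place-nonCrossing Eaw Ezy (a≺z , z≺w , w≺y))
  insert-stop {w = w} Eaw a≺z z≺w w≺y (toInner {z = v} Ezv z≺v v≺y a) with <-cmp (place v) (place w)
  ... | tri< v≺w _ _ = toInner Ezv z≺v v≺w (insert-stop Eaw (<-trans a≺z z≺v) v≺w w≺y a)
  ... | tri≈ _ v≡w _ with refl ← place-injective v≡w = toStop Ezv z≺v a
  ... | tri> _ _ w≺v = ⊥-elim (place-nonCrossing Eaw Ezv (a≺z , z≺w , w≺v))

  firstPlace : List V → ℕ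
  firstPlace []      = 0
  firstPlace (z ∷ _) = place z

  first-arc : ∀ {i x y bs p} → Detours i x y bs p →
    ∃[ w ] (firstPlace p ≡ place w × E x w × x ≺ w × w ≺ y)
  first-arc ((toStop _ _ _ , _) , ¬y)          = ⊥-elim (¬y refl)
  first-arc ((toInner Exz x≺z z≺y _ , _) , _) = _ , refl , Exz , x≺z , z≺y

  reroute : ∀ {x y w bs p} → E x w → x ≺ w → w ≺ y → firstPlace p ≤ place w →
    Ascent x (y ∷ bs) p → ¬ StartsWith y p → Ascent x (w ∷ y ∷ bs) p
  reroute _ _ _ _ (toStop _ _ _) ¬y = ⊥-elim (¬y refl)
  reroute Exw x≺w w≺y z≼w (toInner Exz x≺z z≺y a) _ with m≤n⇒m<n∨m≡n z≼w
  ... | inj₁ z≺w = toInner Exz x≺z z≺w (insert-stop Exw x≺z z≺w w≺y a)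
  ... | inj₂ z≡w with refl ← place-injective z≡w = toStop Exz x≺z a

  atMost-detours : ∀ {i x y bs N} → (∀ w → AtMost N (Ascents i x (w ∷ y ∷ bs))) →
    AtMost N (Detours (suc i) x y bs)
  atMost-detours bound []       _   _ = z≤n
  atMost-detours {i} {x} {y} {bs} bound (p ∷ ps) ps! detours@(d ∷ ds)
    with w , widest≡w , Exw , x≺w , w≺y ← first-arc (argmax-all firstPlace d ds)
    = bound w (p ∷ ps) ps! (All.zipWith rerouted (detours , ranks))
    where
    ranks : All (λ q → firstPlace q ≤ place w) (p ∷ ps)
    ranks = All.map (λ q≤ → ≤-trans q≤ (≤-reflexive widest≡w))
      (f[⊥]≤f[argmax] {f = firstPlace} p ps ∷ f[xs]≤f[argmax] {f = firstPlace} p ps)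
    rerouted : ∀ {q} → Detours (suc i) x y bs q × firstPlace q ≤ place w →
      Ascents i x (w ∷ y ∷ bs) q
    rerouted (((a , len) , ¬y) , q≼w) =
      reroute Exw x≺w w≺y q≼w a ¬y , trans len (cong suc (+-suc _ i))

  atMost-ascents : ∀ i x bs → AtMost (ballot i (length bs)) (Ascents i x bs)
  atMost-ascents zero    x []       = atMost-one λ { (done , _) (done , _) → refl }
  atMost-ascents (suc i) x []       = atMost-none λ { (done , ()) }
  atMost-ascents zero    x (y ∷ bs) = atMost-split (startsWith? y)
    (atMost-toStop (atMost-ascents zero y bs))
    (atMost-none λ (a , ¬y) → ¬y (ascents₀⇒startsWith a))
  atMost-ascents (suc i) x (y ∷ bs) = atMost-split (startsWith? y)
    (atMost-toStop (atMost-ascents (suc i) y bs))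
    (atMost-detours (λ w → atMost-ascents i x (w ∷ y ∷ bs)))

  -- Stepping from the left of y to its right would cross the arc lo–y.
  beyond-arc : ∀ {lo y hi z q} → E lo y → y ≺ hi → Linked E (z ∷ q) →
    All (lo ≺_) (z ∷ q) → All (y ≢_) (z ∷ q) → last (z ∷ q) ≡ just hi →
    All (y ≺_) (z ∷ q)
  beyond-arc {q = []} _ y≺hi _ _ _ refl = y≺hi ∷ []
  beyond-arc {y = y} {z = z} {q = _ ∷ _} Ely y≺hi (Ezb ∷ walk) (lo≺z ∷ lo≺) (y≢z ∷ y≢) end
    with beyond-arc Ely y≺hi walk lo≺ y≢ end
  ... | y≺b∷q@(y≺b ∷ _) with <-cmp (place z) (place y)
  ...   | tri< z≺y _ _ = ⊥-elim (place-nonCrossing Ely Ezb (lo≺z , z≺y , y≺b))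
  ...   | tri≈ _ z≡y _ = ⊥-elim (y≢z (≡.sym (place-injective z≡y)))
  ...   | tri> _ _ y≺z = y≺z ∷ y≺b∷q

  ascent-of-path : ∀ {lo hi y q} → Linked E (lo ∷ y ∷ q) → Unique (y ∷ q) →
    All (lo ≺_) (y ∷ q) → All (_≼ hi) (y ∷ q) → last (y ∷ q) ≡ just hi →
    Ascent lo (hi ∷ []) (y ∷ q)
  ascent-of-path {q = []} (Ely ∷ _) _ (lo≺y ∷ _) _ refl = toStop Ely lo≺y done
  ascent-of-path {hi = hi} {y} {_ ∷ _}
                 (Ely ∷ walk) (y∉ ∷ unique) (lo≺y ∷ lo≺) (y≼hi ∷ ≼hi) end =
    toInner Ely lo≺y y≺hi
      (ascent-of-path walk unique (beyond-arc Ely y≺hi (Linked.tail walk) lo≺ y∉ end) ≼hi end)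
    where
    y≢hi : y ≢ hi
    y≢hi = Maybe.drop-just (subst (Maybe.All (y ≢_)) end (All.last⁺ y∉))
    y≺hi : y ≺ hi
    y≺hi = ≤∧≢⇒< y≼hi (y≢hi ∘ place-injective)

module _ {A : Set} where

  toList-linked : ∀ {R : A → A → Set} {m} (xs : Vec A (suc m)) →
    (∀ i → R (lookup xs (inject₁ i)) (lookup xs (fsuc i))) → Linked R (toList xs)
  toList-linked (x ∷ [])     _ = [-]
  toList-linked (x ∷ y ∷ xs) R = R fzero ∷ toList-linked (y ∷ xs) (R ∘ fsuc)

  toList-unique : ∀ {m} (xs : Vec A m) →
    (∀ i j → lookup xs i ≡ lookup xs j → i ≡ j) → Unique (toList xs)
  toList-unique []       _        = []
  toList-unique (x ∷ xs) distinct =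
    VecAll.toList⁺ (VecAll.lookup⁻ (λ i → Fin.0≢1+n ∘ distinct fzero (fsuc i)))
    ∷ toList-unique xs (λ i j → Fin.suc-injective ∘ distinct (fsuc i) (fsuc j))

  last-toList : ∀ {m} (xs : Vec A (suc m)) → last (toList xs) ≡ just (Vec.last xs)
  last-toList (x ∷ [])     = refl
  last-toList (x ∷ y ∷ xs) = last-toList (y ∷ xs)

paths-atMost : ∀ {n} {G : Graph n} (D : ArcDiagram (Adj G)) {u v} → Ends D u v →
  ∀ r → AtMost (catalan r) (IsPath G (suc r) u v)
paths-atMost {G = G} D {u} {v} (u-first , v-last) r =
  subst (λ N → AtMost N (IsPath G (suc r) u v)) (ballot-catalan r)
    (atMost-injection (toList ∘ Vec.tail) path⇒ascent tail-injective (atMost-ascents D r u (v ∷ [])))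
  where
  open ArcDiagram D
  path⇒ascent : ∀ {p} → IsPath G (suc r) u v p → Ascents D r u (v ∷ []) (toList (Vec.tail p))
  path⇒ascent {_ ∷ y ∷ q} path
    with refl ← IsPath.start path
    with u∉ ∷ unique ← toList-unique (_ ∷ y ∷ q) (IsPath.distinct path) =
      ascent-of-path D (toList-linked _ (IsPath.edges path)) unique
        (All.map (λ u≢z → ≤∧≢⇒< (u-first _) (u≢z ∘ place-injective)) u∉)
        (All.universal v-last _)
        (trans (last-toList (y ∷ q)) (cong just (IsPath.end path)))
      , Vec.length-toList (y ∷ q)
  tail-injective : ∀ {p p′} → IsPath G (suc r) u v p → IsPath G (suc r) u v p′ →
    toList (Vec.tail p) ≡ toList (Vec.tail p′) → p ≡ p′
  tail-injective {_ ∷ q} {_ ∷ q′} path path′ eq =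
    cong₂ _∷_ (trans (IsPath.start path) (≡.sym (IsPath.start path′)))
      (trans (≡.sym (Vec.cast-is-id refl q)) (Vec.toList-injective refl q q′ eq))

PlacedBelow : ∀ {V : Set} {E : V → V → Set} → ℕ → ArcDiagram E → Set
PlacedBelow n D = ∀ x → ArcDiagram.place D x < n

circle : ∀ {n} {G : Graph n} → OuterplanarEmbedding G → ArcDiagram (Adj G)
circle E = record
  { place             = λ x → toℕ (pos E ⟨$⟩ʳ x)
  ; place-injective   = Injection.injective (↔⇒↣ (pos E)) ∘ Fin.toℕ-injective
  ; place-nonCrossing = noCrossing E
  }

circle-placedBelow : ∀ {n} {G : Graph n} (E : OuterplanarEmbedding G) → PlacedBelow n (circle E)
circle-placedBelow E x = Fin.toℕ<n (pos E ⟨$⟩ʳ x)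

module Circular {V : Set} {E : V → V → Set} (E-sym : ∀ {x y} → E x y → E y x)
                {n : ℕ} (D : ArcDiagram E) (below : PlacedBelow n D) where

  open ArcDiagram D

  mirror : ArcDiagram E
  mirror = record
    { place             = λ x → n ∸ suc (place x)
    ; place-injective   = λ eq → place-injective (suc-injective (∸-cancelˡ-≡ (below _) (below _) eq))
    ; place-nonCrossing = λ Eab Ecd (a<c , c<b , b<d) →
        place-nonCrossing (E-sym Ecd) (E-sym Eab) (reflect b<d , reflect c<b , reflect a<c)
    }
    where
    reflect : ∀ {x y} → n ∸ suc x < n ∸ suc y → y < x
    reflect lt = ≰⇒> (λ x≤y → <⇒≱ lt (∸-monoʳ-≤ n (s≤s x≤y)))

  mirror-placedBelow : PlacedBelow n mirror
  mirror-placedBelow x = ∸-monoʳ-< z<s (below x)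

  mirror-succ : ∀ {x y} → suc (place x) ≡ place y →
    suc (ArcDiagram.place mirror y) ≡ ArcDiagram.place mirror x
  mirror-succ {y = y} x→y = trans (≡.sym (+-∸-assoc 1 (below y))) (cong (n ∸_) (≡.sym x→y))

  mirror-first : ∀ {x} → suc (place x) ≡ n → ArcDiagram.place mirror x ≡ 0
  mirror-first x-last = trans (cong (n ∸_) x-last) (n∸n≡0 n)

  mirror-last : ∀ {x} → place x ≡ 0 → suc (ArcDiagram.place mirror x) ≡ n
  mirror-last {x} x≡0 = trans (cong (λ p → suc (n ∸ suc p)) x≡0)
    (subst (λ p → suc (p + (n ∸ suc p)) ≡ n) x≡0 (m+[n∸m]≡n (below x)))

  extremes-ends : ∀ {u v} → place u ≡ 0 → suc (place v) ≡ n → Ends D u v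
  extremes-ends u≡0 v-last =
    (λ x → subst (_≤ place x) (≡.sym u≡0) z≤n)
    , (λ x → ≤-pred (subst (place x <_) (≡.sym v-last) (below x)))

  module _ (s : ℕ) where

    -- Cutting the circle 0, 1, …, n − 1 just before s: the points before s move past n − 1.
    rotateᵈ : ∀ y → Dec (y < s) → ℕ
    rotateᵈ y (yes _) = n + y
    rotateᵈ y (no _)  = y

    rotate : ℕ → ℕ
    rotate y = rotateᵈ y (y <? s)

    data Order : Bool → Bool → ℕ → ℕ → Set where
      unwrapped : ∀ {x y} → s ≤ x → x < y → Order false false x y
      wrapped   : ∀ {x y} → x < y → y < s → Order true true x y
      across    : ∀ {x y} → s ≤ x → y < s → Order false true x y

    order : ∀ {x y} (x? : Dec (x < s)) (y? : Dec (y < s)) → y < n →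
      rotateᵈ x x? < rotateᵈ y y? → Order (does x?) (does y?) x y
    order (yes _)   (yes y<s) _   lt = wrapped (+-cancelˡ-< n _ _ lt) y<s
    order (yes _)   (no _)    y<n lt = ⊥-elim (<-asym y<n (≤-<-trans (m≤m+n n _) lt))
    order (no x≮s) (yes y<s) _   _  = across (≮⇒≥ x≮s) y<s
    order (no x≮s) (no _)    _   lt = unwrapped (≮⇒≥ x≮s) lt

    rotateᵈ-injective : ∀ {x y} (x? : Dec (x < s)) (y? : Dec (y < s)) → x < n → y < n →
      rotateᵈ x x? ≡ rotateᵈ y y? → x ≡ y
    rotateᵈ-injective (yes _) (yes _) _   _   eq = +-cancelˡ-≡ n _ _ eq
    rotateᵈ-injective (yes _) (no _)  _   y<n eq =
      ⊥-elim (<⇒≱ y<n (subst (n ≤_) eq (m≤m+n n _)))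
    rotateᵈ-injective (no _)  (yes _) x<n _   eq =
      ⊥-elim (<⇒≱ x<n (subst (n ≤_) (≡.sym eq) (m≤m+n n _)))
    rotateᵈ-injective (no _)  (no _)  _   _   eq = eq

    rotated : ArcDiagram E
    rotated = record
      { place             = rotate ∘ place
      ; place-injective   = place-injective ∘ rotateᵈ-injective (_ <? s) (_ <? s) (below _) (below _)
      ; place-nonCrossing = λ {a} {b} {c} {d} Eab Ecd (a<c , c<b , b<d) →
          uncross (order (_ <? s) (_ <? s) (below c) a<c) (order (_ <? s) (_ <? s) (below b) c<b)
            (order (_ <? s) (_ <? s) (below d) b<d) Eab Ecd
      }
      where
      -- Each pattern is a crossing of D read from another starting point on the circle.
      uncross : ∀ {a b c d i j k l} → Order i j (place a) (place c) → Order j k (place c) (place b) →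
        Order k l (place b) (place d) → E a b → E c d → ⊥
      uncross (unwrapped _ a<c)   (unwrapped _ c<b) (unwrapped _ b<d) Eab Ecd =
        place-nonCrossing Eab Ecd (a<c , c<b , b<d)
      uncross (unwrapped s≤a a<c) (unwrapped _ c<b) (across _ d<s)    Eab Ecd =
        place-nonCrossing (E-sym Ecd) Eab (<-≤-trans d<s s≤a , a<c , c<b)
      uncross (unwrapped s≤a a<c) (across _ b<s)    (wrapped b<d d<s) Eab Ecd =
        place-nonCrossing (E-sym Eab) (E-sym Ecd) (b<d , <-≤-trans d<s s≤a , a<c)
      uncross (across s≤a c<s)    (wrapped c<b _)   (wrapped b<d d<s) Eab Ecd =
        place-nonCrossing Ecd (E-sym Eab) (c<b , b<d , <-≤-trans d<s s≤a)
      uncross (wrapped a<c _)     (wrapped c<b _)   (wrapped b<d _)   Eab Ecd =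
        place-nonCrossing Eab Ecd (a<c , c<b , b<d)

  cut-between : ∀ {u v} → suc (place v) ≡ place u → Σ[ D′ ∈ ArcDiagram E ] Ends D′ u v
  cut-between {u} {v} v→u = rotated (place u) ,
    (λ x → subst (_≤ rotate (place u) (place x)) (≡.sym (rotateᵈ-self (place u <? place u)))
                 (≥rotateᵈ (place x <? place u)))
    , (λ x → subst (rotate (place u) (place x) ≤_) (≡.sym (rotateᵈ-pred (place v <? place u)))
                   (rotateᵈ≤ (below x) (place x <? place u)))
    where
    rotateᵈ-self : (d : Dec (place u < place u)) → rotateᵈ (place u) (place u) d ≡ place u
    rotateᵈ-self (yes u<u) = ⊥-elim (<-irrefl refl u<u)
    rotateᵈ-self (no _)    = refl
    rotateᵈ-pred : (d : Dec (place v < place u)) → rotateᵈ (place u) (place v) d ≡ n + place v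
    rotateᵈ-pred (yes _)   = refl
    rotateᵈ-pred (no v≮u) = ⊥-elim (v≮u (subst (place v <_) v→u (n<1+n (place v))))
    ≥rotateᵈ : ∀ {y} (d : Dec (y < place u)) → place u ≤ rotateᵈ (place u) y d
    ≥rotateᵈ (yes _)   = ≤-trans (<⇒≤ (below u)) (m≤m+n n _)
    ≥rotateᵈ (no y≮u) = ≮⇒≥ y≮u
    rotateᵈ≤ : ∀ {y} → y < n → (d : Dec (y < place u)) → rotateᵈ (place u) y d ≤ n + place v
    rotateᵈ≤ _   (yes y<u) = +-monoʳ-≤ n (≤-pred (subst (_ <_) (≡.sym v→u) y<u))
    rotateᵈ≤ y<n (no _)    = ≤-trans (<⇒≤ y<n) (m≤m+n n _)

module _ {n} {G : Graph n} (E : OuterplanarEmbedding G) where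

  private
    module C = Circular (Graph.sym G) (circle E) (circle-placedBelow E)
    module M = Circular (Graph.sym G) C.mirror C.mirror-placedBelow

  cut : ∀ {u v} → Consecutive E u v → Σ[ D ∈ ArcDiagram (Adj G) ] Ends D u v
  cut (inj₁ u→v)                              = M.cut-between (C.mirror-succ u→v)
  cut (inj₂ (inj₁ v→u))                       = C.cut-between v→u
  cut (inj₂ (inj₂ (inj₁ (u≡0 , v-last , _)))) = circle E , C.extremes-ends u≡0 v-last
  cut (inj₂ (inj₂ (inj₂ (v≡0 , u-last , _)))) =
    C.mirror , M.extremes-ends (C.mirror-first u-last) (C.mirror-last v≡0)

mainTheorem9 : (r : ℕ) → 1 ≤ r → (n : ℕ) (G : Graph n) (E : OuterplanarEmbedding G)
    → (u v : Fin n) → Consecutive E u v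
    → (ps : List (Vec (Fin n) (suc r))) → Unique ps → All (IsPath G r u v) ps
    → length ps ≤ catalan (r ∸ 1)
mainTheorem9 (suc r) _ n G E u v consecutive with D , ends ← cut E consecutive =
  paths-atMost D ends r
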